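{- Let $G$ and $G'$ be two graphs on the same finite set $V$ of $v$ vertices and let $k$ be an integer. (1) If $3\leq k\leq v-3$ and $h^{(3)}(G_{\restriction K})=h^{(3)}(G'_{\restriction K})$ for all $k$-element subsets $K$ of $V$, then $h^{(3)}(G_{\restriction K})=h^{(3)}(G'_{\restriction K})$ for all $(v-k)$-element subsets $K$ of $V$. (2) If $4\leq k\leq v-4$ and $a^{(0)}(G_{\restriction K})=a^{(0)}(G'_{\restriction K})$ for all $k$-element subsets $K$ of $V$, then $a^{(0)}(G_{\restriction K})=a^{(0)}(G'_{\restriction K})$ for all $(v-k)$-element subsets $K$ of $V$.
   Context: A graph is a pair $G=(V,E)$ with $E$ a set of 2-element subsets of $V$; $\overline G$ is its complement, $E(G)$ its edge set, and $G_{\restriction K}$ the induced subgraph on $K$. A $3$-homogeneous subset of $G$ is a 3-element subset of $V$ all of whose pairs are edges of $G$ or all of whose pairs are non-edges; $h^{(3)}(G)$ is their number. $a^{(0)}(G)$ is the number of unordered pairs $\{u,u'\}$ with $u\in E(G)$, $u'\in E(\overline G)$ and $u\cap u'=\emptyset$. -}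

module Defs where

open import Data.Nat using (ℕ; zero; suc; _+_; _<ᵇ_)
open import Data.Bool using (Bool; true; false; _∧_; _∨_; not; if_then_else_)
open import Data.Fin using (Fin; toℕ)
open import Data.Fin.Subset using (Subset)
open import Data.Vec using (lookup)
open import Data.List using (List; map; allFin)
open import Data.Nat.ListAction using (sum)
open import Relation.Binary.PropositionalEquality using (_≡_)

-- Only pairs of distinct vertices matter (the values
-- adj x x are never used), so this is exactly a set of 2-element subsets.
record Graph (v : ℕ) : Set where
  field
    adj : Fin v → Fin v → Bool
    sym : ∀ x y → adj x y ≡ adj y x
open Graph public

ind : Bool → ℕ
ind true = 1
ind false = 0

_<F_ : ∀ {v} → Fin v → Fin v → Bool
x <F y = toℕ x <ᵇ toℕ y

_≢F_ : ∀ {v} → Fin v → Fin v → Bool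
x ≢F y = (x <F y) ∨ (y <F x)

_∈ᵇ_ : ∀ {v} → Fin v → Subset v → Bool
x ∈ᵇ K = lookup K x

_==_ : Bool → Bool → Bool
true == b = b
false == b = not b

Σv : ∀ {v} → (Fin v → ℕ) → ℕ
Σv {v} f = sum (map f (allFin v))

h3 : ∀ {v} → Graph v → Subset v → ℕ
h3 G K = Σv λ x → Σv λ y → Σv λ z → ind
  ( (x <F y) ∧ (y <F z)
  ∧ (x ∈ᵇ K) ∧ (y ∈ᵇ K) ∧ (z ∈ᵇ K)
  ∧ ((adj G x y == adj G y z) ∧ (adj G y z == adj G x z)) )

-- a⁽⁰⁾(G↾K): the number of unordered pairs {u,u'} with u an edge and u' a
-- non-edge of G↾K, u ∩ u' = ∅.  Since u is an edge and u' a non-edge the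
-- pair is determined by the ordered pair (u , u'); u = {a,b} (a < b),
-- u' = {c,d} (c < d), all in K.
a0 : ∀ {v} → Graph v → Subset v → ℕ
a0 G K = Σv λ a → Σv λ b → Σv λ c → Σv λ d → ind
  ( (a <F b) ∧ (c <F d)
  ∧ (a ∈ᵇ K) ∧ (b ∈ᵇ K) ∧ (c ∈ᵇ K) ∧ (d ∈ᵇ K)
  ∧ (a ≢F c) ∧ (a ≢F d) ∧ (b ≢F c) ∧ (b ≢F d)
  ∧ adj G a b ∧ not (adj G c d) )

-- Write Σ⊆ K t F for the sum of F over the t-element subsets of K.  Both h⁽³⁾ and a⁽⁰⁾ are
-- t-local (t = 3, resp. 4): Φ K = Σ⊆ K t Φ, since each counts configurations of t distinct
-- vertices of K and such a configuration lies in exactly one t-subset of K.  When t ≤ k ≤ v − t,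
-- the values of Σ⊆ K t Φ on the k-sets K determine Φ on the t-sets (the Gottlieb–Kantor
-- full-rank property of the inclusion matrix of t-sets versus k-sets; by induction on v,
-- splitting off the first vertex and double counting the t-subsets of a (k+1)-set over its
-- k-subsets), hence by locality on all sets.  So G and G' agree on every subset of V.
module Submission where

open import Defs hiding (sym)
open import Data.Nat using (ℕ; zero; suc; _+_; _*_; _∸_; _≤_; _<_; z≤n; s≤s; z<s; _≟_; _≤?_)
open import Data.Nat.Properties
open import Data.Bool using (Bool; true; false; _∧_; _∨_; not; T)
open import Data.Bool.Properties using (∧-assoc; ∧-zeroʳ; ∧-identityʳ; T-∧; T-∨)
open import Data.Fin using (Fin; zero; suc; toℕ)
open import Data.Fin.Subset using (Subset; ∣_∣; ⊥; ⁅_⁆; _∪_; ⋃; _∉_)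
open import Data.Fin.Subset.Properties using (∣⊥∣≡0; ∪-identityˡ; ∉⊥; x∈p∪q⁻; x∈⁅y⁆⇒x≡y)
open import Data.List using (List; []; _∷_; map; foldr; length; allFin)
open import Data.Bool.ListAction using (and; all)
open import Data.List.Properties using (map-cong)
open import Data.Nat.ListAction using (sum)
open import Data.List.Relation.Unary.All using (All; []; _∷_)
open import Data.List.Relation.Unary.AllPairs using ([]; _∷_)
open import Data.List.Relation.Unary.Unique.Propositional using (Unique)
open import Data.Vec using ([]; _∷_; here; there)
open import Data.Product using (_×_; _,_)
open import Data.Sum using ([_,_]′)
open import Data.Empty using (⊥-elim)
open import Function using (_∘_; Equivalence)
open import Relation.Nullary using (yes; no)
open import Relation.Binary.PropositionalEquality

Σ⊆ : ∀ {v} → Subset v → ℕ → (Subset v → ℕ) → ℕ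
Σ⊆ []          zero    F = F []
Σ⊆ []          (suc t) F = 0
Σ⊆ (false ∷ K) t       F = Σ⊆ K t (F ∘ (false ∷_))
Σ⊆ (true  ∷ K) zero    F = Σ⊆ K zero (F ∘ (false ∷_))
Σ⊆ (true  ∷ K) (suc t) F = Σ⊆ K (suc t) (F ∘ (false ∷_)) + Σ⊆ K t (F ∘ (true ∷_))

Σ⊆-cong : ∀ {v} (K : Subset v) t {F F' : Subset v → ℕ} →
  (∀ T → ∣ T ∣ ≡ t → F T ≡ F' T) → Σ⊆ K t F ≡ Σ⊆ K t F'
Σ⊆-cong []          zero    e = e [] refl
Σ⊆-cong []          (suc t) e = refl
Σ⊆-cong (false ∷ K) t       e = Σ⊆-cong K t (e ∘ (false ∷_))
Σ⊆-cong (true  ∷ K) zero    e = Σ⊆-cong K zero (e ∘ (false ∷_))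
Σ⊆-cong (true  ∷ K) (suc t) e =
  cong₂ _+_ (Σ⊆-cong K (suc t) (e ∘ (false ∷_))) (Σ⊆-cong K t (λ T → e (true ∷ T) ∘ cong suc))

Σ⊆-0 : ∀ {v} (K : Subset v) t → Σ⊆ K t (λ _ → 0) ≡ 0
Σ⊆-0 []          zero    = refl
Σ⊆-0 []          (suc t) = refl
Σ⊆-0 (false ∷ K) t       = Σ⊆-0 K t
Σ⊆-0 (true  ∷ K) zero    = Σ⊆-0 K zero
Σ⊆-0 (true  ∷ K) (suc t) = cong₂ _+_ (Σ⊆-0 K (suc t)) (Σ⊆-0 K t)

Σ⊆-+ : ∀ {v} (K : Subset v) t (F F' : Subset v → ℕ) →
  Σ⊆ K t (λ T → F T + F' T) ≡ Σ⊆ K t F + Σ⊆ K t F'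
Σ⊆-+ []          zero    F F' = refl
Σ⊆-+ []          (suc t) F F' = refl
Σ⊆-+ (false ∷ K) t       F F' = Σ⊆-+ K t _ _
Σ⊆-+ (true  ∷ K) zero    F F' = Σ⊆-+ K zero _ _
Σ⊆-+ (true  ∷ K) (suc t) F F' = begin
  Σ⊆ K (suc t) (λ T → F₀ T + F₀' T) + Σ⊆ K t (λ T → F₁ T + F₁' T)
    ≡⟨ cong₂ _+_ (Σ⊆-+ K (suc t) F₀ F₀') (Σ⊆-+ K t F₁ F₁') ⟩
  (Σ⊆ K (suc t) F₀ + Σ⊆ K (suc t) F₀') + (Σ⊆ K t F₁ + Σ⊆ K t F₁')
    ≡⟨ +-comm-middle (Σ⊆ K (suc t) F₀) _ _ _ ⟩
  (Σ⊆ K (suc t) F₀ + Σ⊆ K t F₁) + (Σ⊆ K (suc t) F₀' + Σ⊆ K t F₁') ∎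
  where
  open ≡-Reasoning
  F₀ = F ∘ (false ∷_); F₀' = F' ∘ (false ∷_); F₁ = F ∘ (true ∷_); F₁' = F' ∘ (true ∷_)
  +-comm-middle : ∀ a b c d → (a + b) + (c + d) ≡ (a + c) + (b + d)
  +-comm-middle a b c d = begin
    (a + b) + (c + d) ≡⟨ +-assoc a b (c + d) ⟩
    a + (b + (c + d)) ≡⟨ cong (a +_) (+-comm b (c + d)) ⟩
    a + ((c + d) + b) ≡⟨ cong (a +_) (+-assoc c d b) ⟩
    a + (c + (d + b)) ≡⟨ cong (λ x → a + (c + x)) (+-comm d b) ⟩
    a + (c + (b + d)) ≡⟨ +-assoc a c (b + d) ⟨
    (a + c) + (b + d) ∎

Σ⊆-* : ∀ {v} (K : Subset v) t c (F : Subset v → ℕ) → Σ⊆ K t (λ T → c * F T) ≡ c * Σ⊆ K t F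
Σ⊆-* []          zero    c F = refl
Σ⊆-* []          (suc t) c F = sym (*-zeroʳ c)
Σ⊆-* (false ∷ K) t       c F = Σ⊆-* K t c _
Σ⊆-* (true  ∷ K) zero    c F = Σ⊆-* K zero c _
Σ⊆-* (true  ∷ K) (suc t) c F =
  trans (cong₂ _+_ (Σ⊆-* K (suc t) c _) (Σ⊆-* K t c _)) (sym (*-distribˡ-+ c _ _))

Σ⊆-sum : ∀ {v} {A : Set} (K : Subset v) t (F : A → Subset v → ℕ) (xs : List A) →
  Σ⊆ K t (λ T → sum (map (λ x → F x T) xs)) ≡ sum (map (λ x → Σ⊆ K t (F x)) xs)
Σ⊆-sum K t F []       = Σ⊆-0 K t
Σ⊆-sum K t F (x ∷ xs) = trans (Σ⊆-+ K t (F x) _) (cong (Σ⊆ K t (F x) +_) (Σ⊆-sum K t F xs))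

Σ⊆-vanish : ∀ {v} (K : Subset v) t (F : Subset v → ℕ) → ∣ K ∣ < t → Σ⊆ K t F ≡ 0
Σ⊆-vanish []          (suc t) F _         = refl
Σ⊆-vanish (false ∷ K) t       F lt        = Σ⊆-vanish K t _ lt
Σ⊆-vanish (true  ∷ K) (suc t) F (s≤s lt) =
  cong₂ _+_ (Σ⊆-vanish K (suc t) _ (m<n⇒m<1+n lt)) (Σ⊆-vanish K t _ lt)

Σ⊆-self : ∀ {v} (K : Subset v) t (F : Subset v → ℕ) → ∣ K ∣ ≡ t → Σ⊆ K t F ≡ F K
Σ⊆-self []          zero    F _  = refl
Σ⊆-self (false ∷ K) t       F eq = Σ⊆-self K t _ eq
Σ⊆-self (true  ∷ K) (suc t) F eq = begin
  Σ⊆ K (suc t) _ + Σ⊆ K t (F ∘ (true ∷_)) ≡⟨ cong (_+ Σ⊆ K t (F ∘ (true ∷_))) (Σ⊆-vanish K (suc t) _ ∣K∣<1+t) ⟩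
  Σ⊆ K t (F ∘ (true ∷_))                  ≡⟨ Σ⊆-self K t _ (suc-injective eq) ⟩
  F (true ∷ K)                            ∎
  where
  open ≡-Reasoning
  ∣K∣<1+t : ∣ K ∣ < suc t
  ∣K∣<1+t = subst (_< suc t) (sym (suc-injective eq)) (n<1+n t)

-- Each s-subset of B lies in exactly ∣ B ∣ − s of the (∣ B ∣ − 1)-subsets of B.
Σ⊆-double-count : ∀ {v} (B : Subset v) m s (g : Subset v → ℕ) → ∣ B ∣ ≡ suc m →
  Σ⊆ B m (λ K → Σ⊆ K s g) ≡ (suc m ∸ s) * Σ⊆ B s g
Σ⊆-double-count (false ∷ B) m s g eq = Σ⊆-double-count B m s _ eq
Σ⊆-double-count (true  ∷ B) zero zero g eq =
  trans (Σ⊆-self B 0 _ (suc-injective eq)) (sym (+-identityʳ _))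
Σ⊆-double-count (true  ∷ B) zero (suc s) g eq = begin
  Σ⊆ B 0 (λ K → Σ⊆ K (suc s) g₀)     ≡⟨ Σ⊆-self B 0 _ ∣B∣≡0 ⟩
  Σ⊆ B (suc s) g₀                     ≡⟨ Σ⊆-vanish B (suc s) g₀ (subst (_< suc s) (sym ∣B∣≡0) z<s) ⟩
  0                                   ≡⟨ cong (_* Σ⊆ (true ∷ B) (suc s) g) (0∸n≡0 s) ⟨
  (0 ∸ s) * Σ⊆ (true ∷ B) (suc s) g  ∎
  where
  open ≡-Reasoning
  g₀ = g ∘ (false ∷_)
  ∣B∣≡0 = suc-injective eq
Σ⊆-double-count (true  ∷ B) (suc m) zero g eq =
  cong₂ _+_ (Σ⊆-self B (suc m) _ (suc-injective eq)) (Σ⊆-double-count B m zero _ (suc-injective eq))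
Σ⊆-double-count (true  ∷ B) (suc m) (suc s) g eq = begin
  Σ⊆ B (suc m) (λ K → Σ⊆ K (suc s) g₀) + Σ⊆ B m (λ K → Σ⊆ K (suc s) g₀ + Σ⊆ K s g₁)
    ≡⟨ cong₂ _+_ (Σ⊆-self B (suc m) _ ∣B∣≡1+m) (Σ⊆-+ B m _ _) ⟩
  X + (Σ⊆ B m (λ K → Σ⊆ K (suc s) g₀) + Σ⊆ B m (λ K → Σ⊆ K s g₁))
    ≡⟨ cong (X +_) (cong₂ _+_ (Σ⊆-double-count B m (suc s) g₀ ∣B∣≡1+m)
                              (Σ⊆-double-count B m s g₁ ∣B∣≡1+m)) ⟩
  X + ((m ∸ s) * X + (suc m ∸ s) * Y)
    ≡⟨ +-assoc X _ _ ⟨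
  (X + (m ∸ s) * X) + (suc m ∸ s) * Y
    ≡⟨ cong (_+ (suc m ∸ s) * Y) X-absorbs ⟩
  (suc m ∸ s) * X + (suc m ∸ s) * Y
    ≡⟨ *-distribˡ-+ (suc m ∸ s) X Y ⟨
  (suc m ∸ s) * (X + Y) ∎
  where
  open ≡-Reasoning
  g₀ = g ∘ (false ∷_); g₁ = g ∘ (true ∷_)
  ∣B∣≡1+m = suc-injective eq
  X = Σ⊆ B (suc s) g₀
  Y = Σ⊆ B s g₁
  X-absorbs : X + (m ∸ s) * X ≡ (suc m ∸ s) * X
  X-absorbs with s ≤? m
  ... | yes s≤m = cong (_* X) (sym (+-∸-assoc 1 s≤m))
  ... | no s≰m rewrite Σ⊆-vanish B (suc s) g₀ (subst (_< suc s) (sym ∣B∣≡1+m) (s≤s (≰⇒> s≰m))) =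
    trans (*-zeroʳ (m ∸ s)) (sym (*-zeroʳ (suc m ∸ s)))

mutual
  Σ⊆-determines : ∀ {v} t k (F F' : Subset v → ℕ) → t ≤ k → k + t ≤ v →
    (∀ K → ∣ K ∣ ≡ k → Σ⊆ K t F ≡ Σ⊆ K t F') → ∀ T → ∣ T ∣ ≡ t → F T ≡ F' T
  Σ⊆-determines t k F F' t≤k k+t≤v agree T ∣T∣≡t with k ≟ t
  ... | yes refl = begin
    F T         ≡⟨ Σ⊆-self T t F ∣T∣≡t ⟨
    Σ⊆ T t F    ≡⟨ agree T ∣T∣≡t ⟩
    Σ⊆ T t F'   ≡⟨ Σ⊆-self T t F' ∣T∣≡t ⟩
    F' T        ∎
    where open ≡-Reasoning
  ... | no k≢t = Σ⊆-determines-< t k F F' (≤∧≢⇒< t≤k (k≢t ∘ sym)) k+t≤v agree T ∣T∣≡t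

  Σ⊆-determines-< : ∀ {v} t k (F F' : Subset v → ℕ) → t < k → k + t ≤ v →
    (∀ K → ∣ K ∣ ≡ k → Σ⊆ K t F ≡ Σ⊆ K t F') → ∀ T → ∣ T ∣ ≡ t → F T ≡ F' T
  Σ⊆-determines-< {zero} t (suc k) F F' _ () agree T ∣T∣≡t
  Σ⊆-determines-< {suc n} zero (suc k) F F' _ (s≤s k≤n) agree (false ∷ T) ∣T∣≡0 =
    Σ⊆-determines 0 k (F ∘ (false ∷_)) (F' ∘ (false ∷_)) z≤n k≤n
      (λ K ∣K∣≡k → agree (true ∷ K) (cong suc ∣K∣≡k)) T ∣T∣≡0
  Σ⊆-determines-< {suc n} (suc t) (suc k) F F' (s≤s t<k) (s≤s k+1+t≤n) agree = agree-on
    where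
    open ≡-Reasoning
    F₀ = F ∘ (false ∷_); F₀' = F' ∘ (false ∷_); F₁ = F ∘ (true ∷_); F₁' = F' ∘ (true ∷_)
    t≤k = <⇒≤ t<k

    expand : ∀ (H : Subset (suc n) → ℕ) B → ∣ B ∣ ≡ suc k →
      Σ⊆ B k (λ K → Σ⊆ (true ∷ K) (suc t) H)
        ≡ (k ∸ t) * Σ⊆ B (suc t) (H ∘ (false ∷_)) + (suc k ∸ t) * Σ⊆ B t (H ∘ (true ∷_))
    expand H B ∣B∣≡1+k = trans (Σ⊆-+ B k _ _)
      (cong₂ _+_ (Σ⊆-double-count B k (suc t) _ ∣B∣≡1+k) (Σ⊆-double-count B k t _ ∣B∣≡1+k))

    F₁-sums-agree : ∀ B → ∣ B ∣ ≡ suc k → Σ⊆ B t F₁ ≡ Σ⊆ B t F₁'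
    F₁-sums-agree B ∣B∣≡1+k = *-cancelˡ-≡ _ _ (suc (k ∸ t))
      (subst (λ c → c * Σ⊆ B t F₁ ≡ c * Σ⊆ B t F₁') (+-∸-assoc 1 t≤k) weighted)
      where
      weighted : (suc k ∸ t) * Σ⊆ B t F₁ ≡ (suc k ∸ t) * Σ⊆ B t F₁'
      weighted = +-cancelˡ-≡ ((k ∸ t) * Σ⊆ B (suc t) F₀) _ _ (begin
        (k ∸ t) * Σ⊆ B (suc t) F₀ + (suc k ∸ t) * Σ⊆ B t F₁
          ≡⟨ expand F B ∣B∣≡1+k ⟨
        Σ⊆ B k (λ K → Σ⊆ (true ∷ K) (suc t) F)
          ≡⟨ Σ⊆-cong B k (λ K ∣K∣≡k → agree (true ∷ K) (cong suc ∣K∣≡k)) ⟩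
        Σ⊆ B k (λ K → Σ⊆ (true ∷ K) (suc t) F')
          ≡⟨ expand F' B ∣B∣≡1+k ⟩
        (k ∸ t) * Σ⊆ B (suc t) F₀' + (suc k ∸ t) * Σ⊆ B t F₁'
          ≡⟨ cong (λ x → (k ∸ t) * x + (suc k ∸ t) * Σ⊆ B t F₁') (agree (false ∷ B) ∣B∣≡1+k) ⟨
        (k ∸ t) * Σ⊆ B (suc t) F₀ + (suc k ∸ t) * Σ⊆ B t F₁' ∎)

    F₁-agree : ∀ T → ∣ T ∣ ≡ t → F₁ T ≡ F₁' T
    F₁-agree = Σ⊆-determines t (suc k) F₁ F₁' (m≤n⇒m≤1+n t≤k)
      (subst (_≤ n) (+-suc k t) k+1+t≤n) F₁-sums-agree

    F₀-sums-agree : ∀ K → ∣ K ∣ ≡ k → Σ⊆ K (suc t) F₀ ≡ Σ⊆ K (suc t) F₀'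
    F₀-sums-agree K ∣K∣≡k = +-cancelʳ-≡ _ _ _ (begin
      Σ⊆ K (suc t) F₀ + Σ⊆ K t F₁   ≡⟨ agree (true ∷ K) (cong suc ∣K∣≡k) ⟩
      Σ⊆ K (suc t) F₀' + Σ⊆ K t F₁' ≡⟨ cong (Σ⊆ K (suc t) F₀' +_) (Σ⊆-cong K t F₁-agree) ⟨
      Σ⊆ K (suc t) F₀' + Σ⊆ K t F₁  ∎)

    agree-on : ∀ T → ∣ T ∣ ≡ suc t → F T ≡ F' T
    agree-on (false ∷ T) ∣T∣≡1+t = Σ⊆-determines (suc t) k F₀ F₀' t<k k+1+t≤n F₀-sums-agree T ∣T∣≡1+t
    agree-on (true ∷ T)  ∣T∣≡1+t = F₁-agree T (suc-injective ∣T∣≡1+t)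

_⊆ᵇ_ : ∀ {v} → Subset v → Subset v → Bool
[]      ⊆ᵇ []      = true
(a ∷ S) ⊆ᵇ (b ∷ T) = (not a ∨ b) ∧ (S ⊆ᵇ T)

⊆ᵇ-false : ∀ {v} (S T : Subset v) → ∣ T ∣ < ∣ S ∣ → S ⊆ᵇ T ≡ false
⊆ᵇ-false (false ∷ S) (false ∷ T) lt       = ⊆ᵇ-false S T lt
⊆ᵇ-false (false ∷ S) (true  ∷ T) lt       = ⊆ᵇ-false S T (<-trans (n<1+n _) lt)
⊆ᵇ-false (true  ∷ S) (false ∷ T) lt       = refl
⊆ᵇ-false (true  ∷ S) (true  ∷ T) (s≤s lt) = ⊆ᵇ-false S T lt

Σ⊆-⊆ᵇ : ∀ {v} (S K : Subset v) t → ∣ S ∣ ≡ t → Σ⊆ K t (λ T → ind (S ⊆ᵇ T)) ≡ ind (S ⊆ᵇ K)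
Σ⊆-⊆ᵇ []          []          zero    _  = refl
Σ⊆-⊆ᵇ (false ∷ S) (false ∷ K) t       eq = Σ⊆-⊆ᵇ S K t eq
Σ⊆-⊆ᵇ (true  ∷ S) (false ∷ K) t       eq = Σ⊆-0 K t
Σ⊆-⊆ᵇ (false ∷ S) (true  ∷ K) zero    eq = Σ⊆-⊆ᵇ S K zero eq
Σ⊆-⊆ᵇ (false ∷ S) (true  ∷ K) (suc t) eq = begin
  Σ⊆ K (suc t) (λ T → ind (S ⊆ᵇ T)) + Σ⊆ K t (λ T → ind (S ⊆ᵇ T))
    ≡⟨ cong₂ _+_ (Σ⊆-⊆ᵇ S K (suc t) eq) too-small ⟩
  ind (S ⊆ᵇ K) + 0
    ≡⟨ +-identityʳ _ ⟩
  ind (S ⊆ᵇ K) ∎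
  where
  open ≡-Reasoning
  too-small : Σ⊆ K t (λ T → ind (S ⊆ᵇ T)) ≡ 0
  too-small = trans (Σ⊆-cong K t (λ T ∣T∣≡t →
      cong ind (⊆ᵇ-false S T (subst₂ _<_ (sym ∣T∣≡t) (sym eq) (n<1+n t)))))
    (Σ⊆-0 K t)
Σ⊆-⊆ᵇ (true  ∷ S) (true  ∷ K) (suc t) eq =
  cong₂ _+_ (Σ⊆-0 K (suc t)) (Σ⊆-⊆ᵇ S K t (suc-injective eq))

support : ∀ {v} → List (Fin v) → Subset v
support xs = ⋃ (map ⁅_⁆ xs)

⊥-⊆ᵇ : ∀ {v} (T : Subset v) → ⊥ ⊆ᵇ T ≡ true
⊥-⊆ᵇ []      = refl
⊥-⊆ᵇ (_ ∷ T) = ⊥-⊆ᵇ T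

⁅⁆-⊆ᵇ : ∀ {v} (x : Fin v) T → ⁅ x ⁆ ⊆ᵇ T ≡ x ∈ᵇ T
⁅⁆-⊆ᵇ zero    (b ∷ T) = trans (cong (b ∧_) (⊥-⊆ᵇ T)) (∧-identityʳ b)
⁅⁆-⊆ᵇ (suc x) (_ ∷ T) = ⁅⁆-⊆ᵇ x T

∪-⊆ᵇ : ∀ {v} (S S' T : Subset v) → (S ∪ S') ⊆ᵇ T ≡ S ⊆ᵇ T ∧ S' ⊆ᵇ T
∪-⊆ᵇ []      []        []      = refl
∪-⊆ᵇ (a ∷ S) (a' ∷ S') (b ∷ T) =
  trans (cong ((not (a ∨ a') ∨ b) ∧_) (∪-⊆ᵇ S S' T)) (distrib a a' b (S ⊆ᵇ T) (S' ⊆ᵇ T))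
  where
  distrib : ∀ a a' b P Q → (not (a ∨ a') ∨ b) ∧ (P ∧ Q) ≡ ((not a ∨ b) ∧ P) ∧ ((not a' ∨ b) ∧ Q)
  distrib false false b     P Q = refl
  distrib false true  false P Q = sym (∧-zeroʳ P)
  distrib false true  true  P Q = refl
  distrib true  a'    false P Q = refl
  distrib true  false true  P Q = refl
  distrib true  true  true  P Q = refl

support-⊆ᵇ : ∀ {v} (xs : List (Fin v)) T → support xs ⊆ᵇ T ≡ all (_∈ᵇ T) xs
support-⊆ᵇ []       T = ⊥-⊆ᵇ T
support-⊆ᵇ (x ∷ xs) T =
  trans (∪-⊆ᵇ ⁅ x ⁆ (support xs) T) (cong₂ _∧_ (⁅⁆-⊆ᵇ x T) (support-⊆ᵇ xs T))

∉-support : ∀ {v} {x : Fin v} {ys} → All (x ≢_) ys → x ∉ support ys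
∉-support []                 = ∉⊥
∉-support {ys = y ∷ ys} (x≢y ∷ x∉ys) x∈ =
  [ x≢y ∘ x∈⁅y⁆⇒x≡y y , ∉-support x∉ys ]′ (x∈p∪q⁻ ⁅ y ⁆ (support ys) x∈)

∣⁅x⁆∪p∣ : ∀ {v} (x : Fin v) (p : Subset v) → x ∉ p → ∣ ⁅ x ⁆ ∪ p ∣ ≡ suc ∣ p ∣
∣⁅x⁆∪p∣ zero    (false ∷ p) _   = cong (suc ∘ ∣_∣) (∪-identityˡ p)
∣⁅x⁆∪p∣ zero    (true  ∷ p) x∉p = ⊥-elim (x∉p here)
∣⁅x⁆∪p∣ (suc x) (false ∷ p) x∉p = ∣⁅x⁆∪p∣ x p (x∉p ∘ there)
∣⁅x⁆∪p∣ (suc x) (true  ∷ p) x∉p = cong suc (∣⁅x⁆∪p∣ x p (x∉p ∘ there))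

∣support∣ : ∀ {v} {xs : List (Fin v)} → Unique xs → ∣ support xs ∣ ≡ length xs
∣support∣ {v} []                = ∣⊥∣≡0 v
∣support∣ {xs = x ∷ xs} (x∉xs ∷ u) =
  trans (∣⁅x⁆∪p∣ x (support xs) (∉-support x∉xs)) (cong suc (∣support∣ u))

Σ⊆-all-∈ : ∀ {v} (K : Subset v) {xs : List (Fin v)} → Unique xs →
  Σ⊆ K (length xs) (λ T → ind (all (_∈ᵇ T) xs)) ≡ ind (all (_∈ᵇ K) xs)
Σ⊆-all-∈ K {xs} u = begin
  Σ⊆ K (length xs) (λ T → ind (all (_∈ᵇ T) xs))
    ≡⟨ Σ⊆-cong K (length xs) (λ T _ → cong ind (support-⊆ᵇ xs T)) ⟨
  Σ⊆ K (length xs) (λ T → ind (support xs ⊆ᵇ T))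
    ≡⟨ Σ⊆-⊆ᵇ (support xs) K (length xs) (∣support∣ u) ⟩
  ind (support xs ⊆ᵇ K)
    ≡⟨ cong ind (support-⊆ᵇ xs K) ⟩
  ind (all (_∈ᵇ K) xs) ∎
  where open ≡-Reasoning

Local : ∀ {v} → ℕ → (Subset v → ℕ) → Set
Local t Φ = ∀ K → Σ⊆ K t Φ ≡ Φ K

Local-cong : ∀ {v t} {Φ Ψ : Subset v → ℕ} → (∀ K → Φ K ≡ Ψ K) → Local t Φ → Local t Ψ
Local-cong {t = t} Φ≗Ψ local K = trans (Σ⊆-cong K t (λ T _ → sym (Φ≗Ψ T))) (trans (local K) (Φ≗Ψ K))

Σv-cong : ∀ {v} {f g : Fin v → ℕ} → (∀ x → f x ≡ g x) → Σv f ≡ Σv g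
Σv-cong {v} f≗g = cong sum (map-cong f≗g (allFin v))

Σv-local : ∀ {v t} {f : Fin v → Subset v → ℕ} → (∀ x → Local t (f x)) → Local t (λ K → Σv λ x → f x K)
Σv-local {v} {t} {f} local K = trans (Σ⊆-sum K t f (allFin v)) (Σv-cong (λ x → local x K))

weighted-count-local : ∀ {v} β (xs : List (Fin v)) → (T β → Unique xs) →
  Local (length xs) (λ K → ind β * ind (all (_∈ᵇ K) xs))
weighted-count-local β xs unique K = trans (Σ⊆-* K (length xs) (ind β) _) (weighted β unique)
  where
  weighted : ∀ β → (T β → Unique xs) →
    ind β * Σ⊆ K (length xs) (λ T → ind (all (_∈ᵇ T) xs)) ≡ ind β * ind (all (_∈ᵇ K) xs)
  weighted false _      = refl
  weighted true  unique = cong (1 *_) (Σ⊆-all-∈ K (unique _))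

Local-determined : ∀ {v t k} {Φ Φ' : Subset v → ℕ} → Local t Φ → Local t Φ' → t ≤ k → k + t ≤ v →
  (∀ K → ∣ K ∣ ≡ k → Φ K ≡ Φ' K) → ∀ K → Φ K ≡ Φ' K
Local-determined {t = t} {k} {Φ} {Φ'} local local' t≤k k+t≤v agree K = begin
  Φ K         ≡⟨ local K ⟨
  Σ⊆ K t Φ    ≡⟨ Σ⊆-cong K t (Σ⊆-determines t k Φ Φ' t≤k k+t≤v sums-agree) ⟩
  Σ⊆ K t Φ'   ≡⟨ local' K ⟩
  Φ' K        ∎
  where
  open ≡-Reasoning
  sums-agree : ∀ K → ∣ K ∣ ≡ k → Σ⊆ K t Φ ≡ Σ⊆ K t Φ'
  sums-agree K ∣K∣≡k = trans (local K) (trans (agree K ∣K∣≡k) (sym (local' K)))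

ind-∧ : ∀ a b → ind (a ∧ b) ≡ ind a * ind b
ind-∧ false b = refl
ind-∧ true  b = sym (+-identityʳ (ind b))

foldr-∧ : ∀ r bs → foldr _∧_ r bs ≡ and bs ∧ r
foldr-∧ r []       = refl
foldr-∧ r (b ∷ bs) = trans (cong (b ∧_) (foldr-∧ r bs)) (sym (∧-assoc b (and bs) r))

ind-∧-∧-foldr : ∀ a b r bs → ind (a ∧ b ∧ foldr _∧_ r bs) ≡ ind (a ∧ b ∧ r) * ind (and bs)
ind-∧-∧-foldr false b     r bs = refl
ind-∧-∧-foldr true  false r bs = refl
ind-∧-∧-foldr true  true  r bs =
  trans (cong ind (foldr-∧ r bs)) (trans (ind-∧ (and bs) r) (*-comm (ind (and bs)) (ind r)))

T-∧⁻ : ∀ {a b} → T (a ∧ b) → T a × T b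
T-∧⁻ = Equivalence.to T-∧

<F⇒< : ∀ {v} {x y : Fin v} → T (x <F y) → toℕ x < toℕ y
<F⇒< = <ᵇ⇒< _ _

<F⇒≢ : ∀ {v} {x y : Fin v} → T (x <F y) → x ≢ y
<F⇒≢ x<y = <⇒≢ (<F⇒< x<y) ∘ cong toℕ

≢F⇒≢ : ∀ {v} {x y : Fin v} → T (x ≢F y) → x ≢ y
≢F⇒≢ x≢y = [ <F⇒≢ , (λ y<x → <F⇒≢ y<x ∘ sym) ]′ (Equivalence.to T-∨ x≢y)

homogeneous : ∀ {v} → Graph v → Fin v → Fin v → Fin v → Bool
homogeneous G x y z = (adj G x y == adj G y z) ∧ (adj G y z == adj G x z)

unique-<F-<F : ∀ {v} {x y z : Fin v} r → T (x <F y ∧ y <F z ∧ r) → Unique (x ∷ y ∷ z ∷ [])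
unique-<F-<F r p =
  let x<y , rest = T-∧⁻ p
      y<z , _    = T-∧⁻ rest
      x≢z        = <⇒≢ (<-trans (<F⇒< x<y) (<F⇒< y<z)) ∘ cong toℕ
  in (<F⇒≢ x<y ∷ x≢z ∷ []) ∷ (<F⇒≢ y<z ∷ []) ∷ [] ∷ []

h3-weighted : ∀ {v} (G : Graph v) K → h3 G K ≡
  Σv λ x → Σv λ y → Σv λ z → ind (x <F y ∧ y <F z ∧ homogeneous G x y z) * ind (all (_∈ᵇ K) (x ∷ y ∷ z ∷ []))
h3-weighted G K = Σv-cong λ x → Σv-cong λ y → Σv-cong λ z →
  ind-∧-∧-foldr (x <F y) (y <F z) (homogeneous G x y z) (map (_∈ᵇ K) (x ∷ y ∷ z ∷ []))

h3-local : ∀ {v} (G : Graph v) → Local 3 (h3 G)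
h3-local G = Local-cong (λ K → sym (h3-weighted G K))
  (Σv-local λ x → Σv-local λ y → Σv-local λ z →
    weighted-count-local _ (x ∷ y ∷ z ∷ []) (unique-<F-<F (homogeneous G x y z)))

disjoint-edge-nonedge : ∀ {v} → Graph v → Fin v → Fin v → Fin v → Fin v → Bool
disjoint-edge-nonedge G a b c d =
  (a ≢F c) ∧ (a ≢F d) ∧ (b ≢F c) ∧ (b ≢F d) ∧ adj G a b ∧ not (adj G c d)

unique-<F-<F-≢F : ∀ {v} {a b c d : Fin v} r →
  T (a <F b ∧ c <F d ∧ (a ≢F c) ∧ (a ≢F d) ∧ (b ≢F c) ∧ (b ≢F d) ∧ r) → Unique (a ∷ b ∷ c ∷ d ∷ [])
unique-<F-<F-≢F r p =
  let a<b , p₁ = T-∧⁻ p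
      c<d , p₂ = T-∧⁻ p₁
      a≢c , p₃ = T-∧⁻ p₂
      a≢d , p₄ = T-∧⁻ p₃
      b≢c , p₅ = T-∧⁻ p₄
      b≢d , _  = T-∧⁻ p₅
  in (<F⇒≢ a<b ∷ ≢F⇒≢ a≢c ∷ ≢F⇒≢ a≢d ∷ []) ∷ (≢F⇒≢ b≢c ∷ ≢F⇒≢ b≢d ∷ []) ∷ (<F⇒≢ c<d ∷ []) ∷ [] ∷ []

a0-weighted : ∀ {v} (G : Graph v) K → a0 G K ≡
  Σv λ a → Σv λ b → Σv λ c → Σv λ d →
    ind (a <F b ∧ c <F d ∧ disjoint-edge-nonedge G a b c d) * ind (all (_∈ᵇ K) (a ∷ b ∷ c ∷ d ∷ []))
a0-weighted G K = Σv-cong λ a → Σv-cong λ b → Σv-cong λ c → Σv-cong λ d →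
  ind-∧-∧-foldr (a <F b) (c <F d) (disjoint-edge-nonedge G a b c d) (map (_∈ᵇ K) (a ∷ b ∷ c ∷ d ∷ []))

a0-local : ∀ {v} (G : Graph v) → Local 4 (a0 G)
a0-local G = Local-cong (λ K → sym (a0-weighted G K))
  (Σv-local λ a → Σv-local λ b → Σv-local λ c → Σv-local λ d →
    weighted-count-local _ (a ∷ b ∷ c ∷ d ∷ []) (unique-<F-<F-≢F (adj G a b ∧ not (adj G c d))))

proposition3p8 : (v k : ℕ) → (G G' : Graph v) →
    ((3 ≤ k → k + 3 ≤ v →
       ((K : Subset v) → ∣ K ∣ ≡ k → h3 G K ≡ h3 G' K) →
       (K : Subset v) → ∣ K ∣ + k ≡ v → h3 G K ≡ h3 G' K)
    ×
    (4 ≤ k → k + 4 ≤ v →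
       ((K : Subset v) → ∣ K ∣ ≡ k → a0 G K ≡ a0 G' K) →
       (K : Subset v) → ∣ K ∣ + k ≡ v → a0 G K ≡ a0 G' K))
proposition3p8 v k G G' =
  (λ 3≤k k+3≤v agree K _ → Local-determined (h3-local G) (h3-local G') 3≤k k+3≤v agree K) ,
  (λ 4≤k k+4≤v agree K _ → Local-determined (a0-local G) (a0-local G') 4≤k k+4≤v agree K)
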